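{- Let $k\geq 4$ be an integer, let $K$ be a complete subgraph of a graph $G$ with $x\in\{k-1,k,k+1\}$ vertices, and let $u$ be a vertex in $V(G)\setminus V(K)$ that is adjacent to all vertices of $K$. Then for any orientation $\vec K$ of $K$ we have $c_{\mathcal{S}_k}(u,\vec K)\leq (x-k+4)\cdot 2^{k-3}$.
   Context: A tournament is an orientation of a complete graph; it is strongly connected if for every ordered pair of vertices there is a directed path from the first to the second. $\mathcal{S}_k$ is the family of all strongly connected tournaments on $k$ vertices; an orientation is $\mathcal{S}_k$-free if no $k$ of its vertices induce a strongly connected tournament. For an orientation $\vec K$ of $K$ and the vertex $u$, $c_{\mathcal{S}_k}(u,\vec K)$ is the number of ways to orient the edges $\{u,w\}$, $w\in V(K)$, so that the resulting orientation of $G[V(K)\cup\{u\}]$ is $\mathcal{S}_k$-free. -}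

module Defs where

open import Data.Nat using (ℕ; zero; suc)
open import Data.Bool using (Bool; true; false; not)
open import Data.Fin using (Fin; zero; suc)
open import Data.Fin.Subset using (Subset; _∈_; ∣_∣)
open import Data.Vec using (Vec; lookup)
open import Data.List using (List; length)
open import Data.List.Relation.Unary.All using (All)
open import Data.List.Relation.Unary.Unique.Propositional using (Unique)
open import Data.Product using (∃; _×_)
open import Relation.Binary.PropositionalEquality using (_≡_; _≢_)
open import Relation.Nullary using (¬_)

-- An orientation of the complete graph on Fin m (a tournament):
-- T i j ≡ true means the edge {i,j} is oriented i → j.  Diagonal values are irrelevant.
IsTournament : {m : ℕ} → (Fin m → Fin m → Bool) → Set
IsTournament {m} T = ∀ (i j : Fin m) → i ≢ j → T i j ≡ not (T j i)

data Reach {m : ℕ} (T : Fin m → Fin m → Bool) (S : Subset m) : Fin m → Fin m → Set where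
  here : ∀ {i} → Reach T S i i
  step : ∀ {i l j} → T i l ≡ true → l ∈ S → Reach T S l j → Reach T S i j

StronglyConnectedOn : {m : ℕ} → (Fin m → Fin m → Bool) → Subset m → Set
StronglyConnectedOn T S = ∀ i j → i ∈ S → j ∈ S → Reach T S i j

SkFree : (k : ℕ) {m : ℕ} → (Fin m → Fin m → Bool) → Set
SkFree k {m} T = ¬ (∃ λ (S : Subset m) → (∣ S ∣ ≡ k) × StronglyConnectedOn T S)

-- Orientation of K ∪ {u}: vertex zero is u, vertex suc w is the w-th vertex of K.
-- d w ≡ true means the edge {u,w} is oriented u → w.
extend : {x : ℕ} → (Fin x → Fin x → Bool) → Vec Bool x → Fin (suc x) → Fin (suc x) → Bool
extend T d zero    zero    = false
extend T d zero    (suc j) = lookup d j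
extend T d (suc i) zero    = not (lookup d i)
extend T d (suc i) (suc j) = T i j

-- c_{S_k}(u, K⃗) ≤ N : every duplicate-free list of orientations of the edges {u,w}
-- making G[V(K) ∪ {u}] S_k-free has length at most N.
CountAtMost : (k : ℕ) {x : ℕ} → (Fin x → Fin x → Bool) → ℕ → Set
CountAtMost k {x} T N =
  ∀ (ds : List (Vec Bool x)) → Unique ds → All (λ d → SkFree k (extend T d)) ds → length ds Data.Nat.≤ N

record Graph (n : ℕ) : Set₁ where
  field
    Adj   : Fin n → Fin n → Set
    sym   : ∀ {a b} → Adj a b → Adj b a
    irrefl : ∀ {a} → ¬ Adj a a

-- Split the orientations d at u by the direction of one edge {u, a}.  If a → u, deleting a
-- leaves an Sₖ-free extension of K − a, so these are counted by the case with one vertex less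
-- (trivially 2^(x−1) when x = k − 1).  If u → a, call y forced when d must also orient u → y:
-- this happens as soon as a (k−1)-set W ⊆ K contains a and y, a reaches all of W and all of W
-- reaches y, for then u → a and y → u would make W ∪ {u} strongly connected.  Each forced
-- vertex halves the count.
--
-- For x = k − 1, take for a a king and for y an anti-king of K.  For x = k and x = k + 1,
-- either k vertices of K already induce a strong tournament, and nothing is Sₖ-free, or K
-- splits into a top part, reached from its apex a, above at least 2 (resp. 3) vertices;
-- reversing all arcs if necessary, the sinks of the lower vertices of suitable sets W are
-- 2 (resp. 3) forced vertices.  If K is strong but K − a is not, a together with the initial
-- strong component of K − a serves as top part.  This gives 2^(k−2) + 2^(k−3),
-- 3·2^(k−3) + 2^(k−3) and 4·2^(k−3) + 2^(k−3).  The case distinctions on strong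
-- connectivity are classical; they are made under double negation, which is harmless
-- because the conclusion is a decidable inequality.

module Submission where

open import Defs
open import Data.Bool using (Bool; true; false; not)
import Data.Bool as Bool
open import Data.Bool.Properties using (not-injective; not-involutive; ¬-not)
open import Data.Empty using (⊥-elim)
open import Data.Fin using (Fin; zero; suc; punchIn; punchOut; _≟_)
open import Data.Fin.Properties
  using (punchIn-punchOut; punchOut-injective; punchIn-injective; punchInᵢ≢i)
open import Data.Fin.Subset
  using (Subset; _∈_; _∉_; _⊆_; ∣_∣; ⊤; ∁; _-_; ⁅_⁆; inside; outside)
open import Data.Fin.Subset.Properties
  using (∈⊤; ∣⊤∣≡n; _∈?_; x∈p∩q⁺; x∈p∩q⁻; x∈∁p⇒x∉p; x∉p⇒x∈∁p; x∉∁p⇒x∈p; x∈p⇒x∉∁p;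
         x∈p∧x≢y⇒x∈p-y; p─q⊆p; p─⊥≡p; ∣∁p∣≡n∸∣p∣; ∣p∣≤n)
open import Data.List using (List; []; _∷_; length; map; filter; allFin)
open import Data.List.Properties using (length-map)
open import Data.List.Membership.Propositional.Properties using (∈-filter⁺; ∈-allFin)
open import Data.List.Relation.Unary.All as All using (All; []; _∷_)
open import Data.List.Relation.Unary.All.Properties as All using (all-filter)
open import Data.List.Relation.Unary.AllPairs using ([]; _∷_)
open import Data.List.Relation.Unary.Any using (there)
open import Data.List.Relation.Unary.Unique.Propositional using (Unique)
import Data.List.Relation.Unary.Unique.Propositional.Properties as Unique
open import Data.Nat using (ℕ; zero; suc; _+_; _*_; _∸_; _^_; _≤_; z≤n; s≤s; s≤s⁻¹; _≤?_)
open import Data.Nat.Properties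
  using (+-suc; +-comm; +-assoc; +-identityʳ; +-mono-≤; +-monoˡ-≤; +-cancelˡ-≤; ≤-trans; ≰⇒>;
         m+n∸n≡m; m+[n∸m]≡n; suc-injective; module ≤-Reasoning)
open import Data.Product as Product using (∃; ∃₂; _×_; _,_; proj₁; proj₂)
open import Data.Sum using (_⊎_; inj₁; inj₂)
open import Data.Vec as Vec using (Vec; []; _∷_; lookup; insertAt; removeAt; here; there)
open import Data.Vec.Properties
  using (insertAt-removeAt; insertAt-punchIn; insertAt-lookup; lookup-map; ∷-injective;
         []=⇒lookup; lookup⇒[]=; lookup∘tabulate)
open import Effect.Monad using (RawMonad)
open import Level using (0ℓ)
open import Function using (_∘_)
open import Function.Definitions using (Injective)
open import Relation.Binary.PropositionalEquality
  using (_≡_; _≢_; refl; sym; trans; cong; cong₂; subst; ≢-sym)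
open import Relation.Nullary using (¬_; Dec; yes; no; does)
open import Relation.Nullary.Decidable using (decidable-stable; dec-true; ¬?; _⊎-dec_)
open import Relation.Nullary.Negation using (¬¬-Monad; ¬¬-map; contradiction)
open import Relation.Nullary.Decidable.Core using (¬¬-excluded-middle)

private
  variable
    m n k N N₀ N₁ : ℕ
    A B : Set

Arcs : ℕ → Set
Arcs m = Fin m → Fin m → Bool

-- CountAtMost k T N is definitionally Count (λ d → SkFree k (extend T d)) N.
Count : (A → Set) → ℕ → Set
Count {A} P N = ∀ (xs : List A) → Unique xs → All P xs → length xs ≤ N

length-filter-¬ : {P : A → Set} (P? : ∀ x → Dec (P x)) (xs : List A) →
                  length (filter (¬? ∘ P?) xs) + length (filter P? xs) ≡ length xs
length-filter-¬ P? []       = refl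
length-filter-¬ P? (x ∷ xs) with P? x
... | yes _ = trans (+-suc _ _) (cong suc (length-filter-¬ P? xs))
... | no  _ = cong suc (length-filter-¬ P? xs)

count-mono : {P Q : A → Set} → (∀ {x} → P x → Q x) → Count Q N → Count P N
count-mono P⇒Q c xs u ps = c xs u (All.map P⇒Q ps)

module _ {P : A → Set} where

  count-∅ : (∀ {x} → ¬ P x) → Count P N
  count-∅ ¬P []      _ _       = z≤n
  count-∅ ¬P (_ ∷ _) _ (p ∷ _) = contradiction p ¬P

  count-stable : ¬ ¬ Count P N → Count P N
  count-stable ¬¬c xs u ps = decidable-stable (length xs ≤? _) (¬¬-map (λ c → c xs u ps) ¬¬c)

  count-split : {Q : A → Set} (Q? : ∀ x → Dec (Q x)) →
                Count (λ x → P x × ¬ Q x) N₀ → Count (λ x → P x × Q x) N₁ → Count P (N₀ + N₁)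
  count-split Q? c₀ c₁ xs u ps =
    subst (_≤ _) (length-filter-¬ Q? xs) (+-mono-≤ (filtered (¬? ∘ Q?) c₀) (filtered Q? c₁))
    where
    filtered : ∀ {R : A → Set} (R? : ∀ x → Dec (R x)) →
               Count (λ x → P x × R x) N → length (filter R? xs) ≤ N
    filtered R? c = c _ (Unique.filter⁺ R? u) (All.zip (All.filter⁺ R? ps , all-filter R? xs))

module _ {P : A → Set} {Q : B → Set} (f : A → B)
         (f-injective : ∀ {x y} → P x → P y → f x ≡ f y → x ≡ y) where

  private
    unique-map : ∀ {xs} → All P xs → Unique xs → Unique (map f xs)
    unique-map []        []         = []
    unique-map (px ∷ ps) (x∉xs ∷ u) =
      All.map⁺ (All.zipWith (λ (py , x≢y) → x≢y ∘ f-injective px py) (ps , x∉xs)) ∷ unique-map ps u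

  count-preimage : (∀ {x} → P x → Q (f x)) → Count Q N → Count P N
  count-preimage P⇒Qf c xs u ps =
    subst (_≤ _) (length-map f xs) (c (map f xs) (unique-map ps u) (All.map⁺ (All.map P⇒Qf ps)))

removeAt-injective : (d e : Vec A (suc n)) (a : Fin (suc n)) →
                     lookup d a ≡ lookup e a → removeAt d a ≡ removeAt e a → d ≡ e
removeAt-injective d e a da≡ea d∖a≡e∖a =
  trans (sym (insertAt-removeAt d a))
        (trans (cong₂ (λ r v → insertAt r a v) d∖a≡e∖a da≡ea) (insertAt-removeAt e a))

count-fixed-at : (a : Fin (suc n)) (c : Bool) {P : Vec Bool (suc n) → Set} →
            Count (λ e → P (insertAt e a c)) N → Count (λ d → P d × lookup d a ≡ c) N
count-fixed-at a c {P} = count-preimage (λ d → removeAt d a)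
  (λ (_ , da) (_ , ea) → removeAt-injective _ _ a (trans da (sym ea)))
  (λ {d} (pd , da) → subst P (sym (reinsert d da)) pd)
  where
  reinsert : ∀ d → lookup d a ≡ c → insertAt (removeAt d a) a c ≡ d
  reinsert d da = trans (cong (insertAt _ a) (sym da)) (insertAt-removeAt d a)

count-split-at : (a : Fin (suc n)) {P : Vec Bool (suc n) → Set} →
                 Count (λ d → P d × lookup d a ≡ false) N₀ →
                 Count (λ d → P d × lookup d a ≡ true) N₁ → Count P (N₀ + N₁)
count-split-at a c₀ = count-split (λ d → lookup d a Bool.≟ true) (count-mono (Product.map₂ ¬-not) c₀)

count-all : ∀ n {P : Vec Bool n → Set} → Count P (2 ^ n)
count-all zero    []            _               _ = z≤n
count-all zero    (_ ∷ [])      _               _ = s≤s z≤n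
count-all zero    ([] ∷ [] ∷ _) ((≢[] ∷ _) ∷ _) _ = contradiction refl ≢[]
count-all (suc n) = subst (Count _) (cong (2 ^ n +_) (sym (+-identityʳ (2 ^ n))))
  (count-split-at zero (count-fixed-at zero false (count-all n)) (count-fixed-at zero true (count-all n)))

module _ {y : Fin (suc n)} where

  punchOuts : ∀ {zs} → All (y ≢_) zs → List (Fin n)
  punchOuts []         = []
  punchOuts (y≢z ∷ ps) = punchOut y≢z ∷ punchOuts ps

  length-punchOuts : ∀ {zs} (ps : All (y ≢_) zs) → length (punchOuts ps) ≡ length zs
  length-punchOuts []       = refl
  length-punchOuts (_ ∷ ps) = cong suc (length-punchOuts ps)

  punchOuts-unique : ∀ {zs} (ps : All (y ≢_) zs) → Unique zs → Unique (punchOuts ps)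
  punchOuts-unique []         []         = []
  punchOuts-unique (y≢z ∷ ps) (z∉zs ∷ u) = distinct ps z∉zs ∷ punchOuts-unique ps u
    where
    distinct : ∀ {ws} (qs : All (y ≢_) ws) → All (_ ≢_) ws → All (punchOut y≢z ≢_) (punchOuts qs)
    distinct []         []           = []
    distinct (y≢w ∷ qs) (z≢w ∷ z∉ws) = (z≢w ∘ punchOut-injective y≢z y≢w) ∷ distinct qs z∉ws

  All-punchOuts : ∀ {zs} (ps : All (y ≢_) zs) {e : Vec A n} {v c : A} →
                  All (λ z → lookup (insertAt e y v) z ≡ c) zs → All (λ z → lookup e z ≡ c) (punchOuts ps)
  All-punchOuts []         []       = []
  All-punchOuts (y≢z ∷ ps) {e} {v} (ez ∷ es) =
    trans (sym (insertAt-punchIn e y v _)) (trans (cong (lookup (insertAt e y v)) (punchIn-punchOut y≢z)) ez)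
    ∷ All-punchOuts ps es

TrueOn : Vec Bool n → List (Fin n) → Set
TrueOn d ys = All (λ y → lookup d y ≡ true) ys

count-all-true : ∀ n (ys : List (Fin n)) → Unique ys → Count (λ d → TrueOn d ys) (2 ^ (n ∸ length ys))
count-all-true n       []       _            = count-all n
count-all-true (suc n) (y ∷ ys) (y∉ys ∷ u) =
  count-mono (λ { (dy ∷ dys) → dys , dy })
    (count-fixed-at y true (count-mono (λ {e} → All-punchOuts y∉ys {e}) rest))
  where
  rest : Count (λ e → TrueOn e (punchOuts y∉ys)) (2 ^ (n ∸ length ys))
  rest = subst (λ l → Count (λ e → TrueOn e (punchOuts y∉ys)) (2 ^ (n ∸ l)))
               (length-punchOuts y∉ys)
           (count-all-true n (punchOuts y∉ys) (punchOuts-unique y∉ys u))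

module _ {T : Arcs m} {S : Subset m} where

  infixr 5 _◅◅_
  _◅◅_ : ∀ {i j l} → Reach T S i j → Reach T S j l → Reach T S i l
  here         ◅◅ q = q
  step e l∈S p ◅◅ q = step e l∈S (p ◅◅ q)

  edge : ∀ {i j} → T i j ≡ true → j ∈ S → Reach T S i j
  edge e j∈S = step e j∈S here

  Reach-⊆ : ∀ {S′} → S ⊆ S′ → ∀ {i j} → Reach T S i j → Reach T S′ i j
  Reach-⊆ S⊆S′ here         = here
  Reach-⊆ S⊆S′ (step e l∈S p) = step e (S⊆S′ l∈S) (Reach-⊆ S⊆S′ p)

  Reach-restrict : ∀ {S′ q} → (∀ {l} → l ∈ S → Reach T S l q → l ∈ S′) →
                   ∀ {p} → Reach T S p q → Reach T S′ p q
  Reach-restrict on-path here           = here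
  Reach-restrict on-path (step e l∈S r) = step e (on-path l∈S r) (Reach-restrict on-path r)

  Reach-crossing : ∀ (X : Subset m) {p q} → Reach T S p q → p ∉ X → q ∈ X →
                   ∃₂ λ l l′ → l ∉ X × l′ ∈ X × T l l′ ≡ true
  Reach-crossing X here           p∉X q∈X = contradiction q∈X p∉X
  Reach-crossing X (step {l = l} e _ r) p∉X q∈X with l ∈? X
  ... | yes l∈X = _ , l , p∉X , l∈X , e
  ... | no  l∉X = Reach-crossing X r l∉X q∈X

  strong-via-hub : ∀ {h} → (∀ {i} → i ∈ S → Reach T S i h) → (∀ {j} → j ∈ S → Reach T S h j) →
                   StronglyConnectedOn T S
  strong-via-hub to-h from-h i j i∈S j∈S = to-h i∈S ◅◅ from-h j∈S

Reach-map : ∀ {m′} {E : Arcs m} {E′ : Arcs m′} {S S′} (f : Fin m → Fin m′) →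
            (∀ i j → E i j ≡ E′ (f i) (f j)) → (∀ {l} → l ∈ S → f l ∈ S′) →
            ∀ {i j} → Reach E S i j → Reach E′ S′ (f i) (f j)
Reach-map f E≡E′ f∈ here           = here
Reach-map f E≡E′ f∈ (step e l∈S p) = step (trans (sym (E≡E′ _ _)) e) (f∈ l∈S) (Reach-map f E≡E′ f∈ p)

Reach-reverse : ∀ {E E′ : Arcs m} {S} → (∀ i j → E i j ≡ E′ j i) →
                ∀ {i j} → i ∈ S → Reach E S i j → Reach E′ S j i
Reach-reverse E≡E′ i∈S here           = here
Reach-reverse E≡E′ i∈S (step e l∈S p) = Reach-reverse E≡E′ l∈S p ◅◅ edge (trans (sym (E≡E′ _ _)) e) i∈S

reverse : Arcs m → Arcs m
reverse T i j = T j i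

deleteVertex : Arcs (suc m) → Fin (suc m) → Arcs m
deleteVertex T a i j = T (punchIn a i) (punchIn a j)

module _ {T : Arcs m} (tour : IsTournament T) where

  beats-unless : ∀ {i j} → i ≢ j → ¬ (T j i ≡ true) → T i j ≡ true
  beats-unless {i} {j} i≢j ¬j→i with T j i in ji
  ... | true  = contradiction refl ¬j→i
  ... | false = trans (tour i j i≢j) (cong not ji)

  ¬mutual : ∀ {i j} → i ≢ j → T i j ≡ true → ¬ (T j i ≡ true)
  ¬mutual {i} {j} i≢j ij ji with () ← trans (sym ij) (trans (tour i j i≢j) (cong not ji))

  reverse-tournament : IsTournament (reverse T)
  reverse-tournament i j i≢j = tour j i (≢-sym i≢j)

deleteVertex-tournament : {T : Arcs (suc m)} → IsTournament T → (a : Fin (suc m)) →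
                          IsTournament (deleteVertex T a)
deleteVertex-tournament tour a i j i≢j = tour _ _ (i≢j ∘ punchIn-injective a i j)

module _ {T : Arcs m} (tour : IsTournament T) {S : Subset m} where

  private
    king-list : ∀ z L → All (_∈ S) (z ∷ L) → ∃ λ a → a ∈ S × All (Reach T S a) (z ∷ L)
    king-list z []      (z∈S ∷ [])  = z , z∈S , here ∷ []
    king-list z (v ∷ L) (z∈S ∷ L⊆S) with king-list v L L⊆S
    ... | a , a∈S , from-a with T z a in za
    ...   | true  = z , z∈S , here ∷ All.map (step za a∈S) from-a
    ...   | false with z ≟ a
    ...     | yes refl = a , a∈S , here ∷ from-a
    ...     | no  z≢a  = a , a∈S , edge (trans (tour a z (≢-sym z≢a)) (cong not za)) z∈S ∷ from-a

  king : ∀ {z} → z ∈ S → ∃ λ a → a ∈ S × (∀ {j} → j ∈ S → Reach T S a j)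
  king {z} z∈S with king-list z (filter (_∈? S) (allFin m)) (z∈S ∷ all-filter (_∈? S) (allFin m))
  ... | a , a∈S , from-a =
    a , a∈S , λ {j} j∈S → All.lookup from-a (there (∈-filter⁺ (_∈? S) (∈-allFin j) j∈S))

co-king : {T : Arcs m} → IsTournament T → ∀ {S z} → z ∈ S →
          ∃ λ b → b ∈ S × (∀ {j} → j ∈ S → Reach T S j b)
co-king tour z∈S with king (reverse-tournament tour) z∈S
... | b , b∈S , from-b = b , b∈S , λ j∈S → Reach-reverse (λ _ _ → refl) b∈S (from-b j∈S)

fromDec : {P : Fin n → Set} → (∀ i → Dec (P i)) → Subset n
fromDec P? = Vec.tabulate (λ i → does (P? i))

module _ {P : Fin n → Set} (P? : ∀ i → Dec (P i)) where

  ∈fromDec⁺ : ∀ {i} → P i → i ∈ fromDec P?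
  ∈fromDec⁺ {i} p = lookup⇒[]= i _ (trans (lookup∘tabulate _ i) (dec-true (P? i) p))

  ∈fromDec⁻ : ∀ {i} → i ∈ fromDec P? → P i
  ∈fromDec⁻ {i} i∈ with P? i in eq
  ... | yes p = p
  ... | no ¬p with () ← trans (sym ([]=⇒lookup i∈)) (trans (lookup∘tabulate _ i) (cong does eq))

x∉p-x : (p : Subset n) (x : Fin n) → x ∉ p - x
x∉p-x (s ∷ p) (suc x) (there x∈) = x∉p-x p x x∈

x∈p-y⇒x≢y : ∀ {p : Subset n} {x y} → x ∈ p - y → x ≢ y
x∈p-y⇒x≢y {p = p} x∈ refl = x∉p-x p _ x∈

x∈p-y⇒x∈p : ∀ {p : Subset n} {x y} → x ∈ p - y → x ∈ p
x∈p-y⇒x∈p {p = p} {y = y} = p─q⊆p p ⁅ y ⁆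

∣p-x∣+1≡∣p∣ : (p : Subset n) {x : Fin n} → x ∈ p → suc ∣ p - x ∣ ≡ ∣ p ∣
∣p-x∣+1≡∣p∣ (inside  ∷ p) here        = cong (suc ∘ ∣_∣) (p─⊥≡p p)
∣p-x∣+1≡∣p∣ (inside  ∷ p) (there x∈p) = cong suc (∣p-x∣+1≡∣p∣ p x∈p)
∣p-x∣+1≡∣p∣ (outside ∷ p) (there x∈p) = ∣p-x∣+1≡∣p∣ p x∈p

∣⊤-x∣≡n : (x : Fin (suc n)) → ∣ ⊤ - x ∣ ≡ n
∣⊤-x∣≡n {n} x = suc-injective (trans (∣p-x∣+1≡∣p∣ ⊤ {x} ∈⊤) (∣⊤∣≡n (suc n)))

⊆⊤ : ∀ {p : Subset n} → p ⊆ ⊤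
⊆⊤ _ = ∈⊤

⊆- : ∀ {p q : Subset n} {v} → p ⊆ q → v ∉ p → p ⊆ q - v
⊆- p⊆q v∉p w∈p = x∈p∧x≢y⇒x∈p-y (p⊆q w∈p) (λ { refl → v∉p w∈p })

⊆⊤-₂ : ∀ {p : Subset n} {v w} → v ∉ p → w ∉ p → p ⊆ ⊤ - v - w
⊆⊤-₂ v∉p w∉p = ⊆- (⊆- ⊆⊤ v∉p) w∉p

∈⊤- : ∀ {v w : Fin n} → w ≢ v → w ∈ ⊤ - v
∈⊤- = x∈p∧x≢y⇒x∈p-y ∈⊤

∈⊤-₂ : ∀ {v w x : Fin n} → x ≢ v → x ≢ w → x ∈ ⊤ - v - w
∈⊤-₂ x≢v = x∈p∧x≢y⇒x∈p-y (∈⊤- x≢v)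

∈⊤-₂⁻ : ∀ {v w x : Fin n} → x ∈ ⊤ - v - w → x ≢ v × x ≢ w
∈⊤-₂⁻ x∈ = x∈p-y⇒x≢y (x∈p-y⇒x∈p x∈) , x∈p-y⇒x≢y x∈

∣⊤-v-w∣+1≡n : ∀ {v w : Fin (suc n)} → w ≢ v → suc ∣ ⊤ - v - w ∣ ≡ n
∣⊤-v-w∣+1≡n {v = v} w≢v = trans (∣p-x∣+1≡∣p∣ (⊤ - v) (∈⊤- w≢v)) (∣⊤-x∣≡n v)

∃-member : (p : Subset n) → 1 ≤ ∣ p ∣ → ∃ (_∈ p)
∃-member (inside  ∷ p) _  = zero , here
∃-member (outside ∷ p) 1≤ = Product.map suc there (∃-member p 1≤)

remove-member : ∀ {j} (p : Subset n) → suc j ≤ ∣ p ∣ → ∃ λ e → e ∈ p × j ≤ ∣ p - e ∣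
remove-member {j = j} p h with ∃-member p (≤-trans (s≤s z≤n) h)
... | e , e∈p = e , e∈p , s≤s⁻¹ (subst (suc j ≤_) (sym (∣p-x∣+1≡∣p∣ p e∈p)) h)

Distinct₂ Distinct₃ : (Fin n → Set) → Set
Distinct₂ P = ∃₂ λ e₁ e₂ → (P e₁ × P e₂) × e₁ ≢ e₂
Distinct₃ P = ∃₂ λ e₁ e₂ → ∃ λ e₃ → (P e₁ × P e₂ × P e₃) × (e₁ ≢ e₂ × e₁ ≢ e₃ × e₂ ≢ e₃)

Distinct₂-map : {P Q : Fin n → Set} → (∀ {x} → P x → Q x) → Distinct₂ P → Distinct₂ Q
Distinct₂-map f (e₁ , e₂ , (p₁ , p₂) , e₁≢e₂) = e₁ , e₂ , (f p₁ , f p₂) , e₁≢e₂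

Distinct₃-map : {P Q : Fin n → Set} → (∀ {x} → P x → Q x) → Distinct₃ P → Distinct₃ Q
Distinct₃-map f (e₁ , e₂ , e₃ , (p₁ , p₂ , p₃) , ≢s) = e₁ , e₂ , e₃ , (f p₁ , f p₂ , f p₃) , ≢s

distinct₂ : (p : Subset n) → 2 ≤ ∣ p ∣ → Distinct₂ (_∈ p)
distinct₂ p h with remove-member p h
... | e₁ , e₁∈p , h₁ with ∃-member (p - e₁) h₁
... | e₂ , e₂∈p-e₁ = e₁ , e₂ , (e₁∈p , x∈p-y⇒x∈p e₂∈p-e₁) , ≢-sym (x∈p-y⇒x≢y e₂∈p-e₁)

distinct₃ : (p : Subset n) → 3 ≤ ∣ p ∣ → Distinct₃ (_∈ p)
distinct₃ p h with remove-member p h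
... | e₁ , e₁∈p , h₁ with distinct₂ (p - e₁) h₁
... | e₂ , e₃ , (e₂∈ , e₃∈) , e₂≢e₃ =
  e₁ , e₂ , e₃ , (e₁∈p , x∈p-y⇒x∈p e₂∈ , x∈p-y⇒x∈p e₃∈) ,
  (≢-sym (x∈p-y⇒x≢y e₂∈) , ≢-sym (x∈p-y⇒x≢y e₃∈) , e₂≢e₃)

∣p∣+∣∁p∣ : (p : Subset n) → ∣ p ∣ + ∣ ∁ p ∣ ≡ n
∣p∣+∣∁p∣ p = trans (cong (∣ p ∣ +_) (∣∁p∣≡n∸∣p∣ p)) (m+[n∸m]≡n (∣p∣≤n p))

pigeonhole : ∀ j (p : Subset n) → j + j ≤ suc n → j ≤ ∣ p ∣ ⊎ j ≤ ∣ ∁ p ∣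
pigeonhole {n} j p h with j ≤? ∣ p ∣
... | yes j≤∣p∣ = inj₁ j≤∣p∣
... | no  j≰∣p∣ = inj₂ (+-cancelˡ-≤ j _ _ (begin
  j + j              ≤⟨ h ⟩
  suc n              ≡⟨ cong suc (∣p∣+∣∁p∣ p) ⟨
  suc ∣ p ∣ + ∣ ∁ p ∣ ≤⟨ +-monoˡ-≤ _ (≰⇒> j≰∣p∣) ⟩
  j + ∣ ∁ p ∣        ∎))
  where open ≤-Reasoning

module _ {x} {T : Arcs x} {d : Vec Bool x} where

  lift : ∀ c {W i j} → Reach T W i j → Reach (extend T d) (c ∷ W) (suc i) (suc j)
  lift c = Reach-map suc (λ _ _ → refl) there

  ¬free-through-u : ∀ {W a b} → suc ∣ W ∣ ≡ k → a ∈ W →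
                    (∀ {j} → j ∈ W → Reach T W a j) → (∀ {j} → j ∈ W → Reach T W j b) →
                    lookup d a ≡ true → lookup d b ≡ false → ¬ SkFree k (extend T d)
  ¬free-through-u {W = W} {a = a} {b = b} ∣W∣+1≡k a∈W from-a to-b da db free =
    free (inside ∷ W , ∣W∣+1≡k , strong-via-hub to-u from-u)
    where
    to-u : ∀ {i} → i ∈ inside ∷ W → Reach (extend T d) (inside ∷ W) i zero
    to-u here        = here
    to-u (there i∈W) = lift inside (to-b i∈W) ◅◅ edge (cong not db) here
    from-u : ∀ {j} → j ∈ inside ∷ W → Reach (extend T d) (inside ∷ W) zero j
    from-u here        = here
    from-u (there j∈W) = step da (there a∈W) (lift inside (from-a j∈W))

  ¬free-of-strong : ∀ {W} → ∣ W ∣ ≡ k → StronglyConnectedOn T W → ¬ SkFree k (extend T d)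
  ¬free-of-strong {W = W} ∣W∣≡k strong free = free (outside ∷ W , ∣W∣≡k , strong′)
    where
    strong′ : StronglyConnectedOn (extend T d) (outside ∷ W)
    strong′ (suc i) (suc j) (there i∈W) (there j∈W) = lift outside (strong i j i∈W j∈W)

count-of-strong : ∀ {x} {T : Arcs x} {W} → ∣ W ∣ ≡ k → StronglyConnectedOn T W → CountAtMost k T N
count-of-strong ∣W∣≡k strong = count-∅ (λ {d} → ¬free-of-strong {d = d} ∣W∣≡k strong)

free-induced : ∀ (p : Fin (suc m)) {E : Arcs (suc m)} {E′ : Arcs m} →
               (∀ i j → E′ i j ≡ E (punchIn p i) (punchIn p j)) → SkFree k E → SkFree k E′
free-induced p {E} {E′} E′≡E free (S , ∣S∣≡k , strong) =
  free (S⁺ , trans (∣insertAt-outside∣ S p) ∣S∣≡k , strong⁺)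
  where
  S⁺ = insertAt S p outside

  ∣insertAt-outside∣ : ∀ {n} (S : Subset n) p → ∣ insertAt S p outside ∣ ≡ ∣ S ∣
  ∣insertAt-outside∣ S             zero    = refl
  ∣insertAt-outside∣ (inside  ∷ S) (suc p) = cong suc (∣insertAt-outside∣ S p)
  ∣insertAt-outside∣ (outside ∷ S) (suc p) = ∣insertAt-outside∣ S p

  punchIn-∈ : ∀ {j} → j ∈ S → punchIn p j ∈ S⁺
  punchIn-∈ {j} j∈S = lookup⇒[]= _ _ (trans (insertAt-punchIn S p outside j) ([]=⇒lookup j∈S))

  punchIn-of : ∀ {i} → i ∈ S⁺ → ∃ λ j → punchIn p j ≡ i × j ∈ S
  punchIn-of {i} i∈S⁺ with p ≟ i
  ... | yes refl with () ← trans (sym (insertAt-lookup S p outside)) ([]=⇒lookup i∈S⁺)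
  ... | no  p≢i = punchOut p≢i , punchIn-punchOut p≢i ,
    lookup⇒[]= _ _ (trans (sym (insertAt-punchIn S p outside _))
                          (trans (cong (lookup S⁺) (punchIn-punchOut p≢i)) ([]=⇒lookup i∈S⁺)))

  strong⁺ : StronglyConnectedOn E S⁺
  strong⁺ i j i∈ j∈ with punchIn-of i∈ | punchIn-of j∈
  ... | i′ , refl , i′∈S | j′ , refl , j′∈S =
    Reach-map (punchIn p) E′≡E punchIn-∈ (strong i′ j′ i′∈S j′∈S)

free-deleteVertex : ∀ {T : Arcs (suc m)} a {e} c →
                    SkFree k (extend T (insertAt e a c)) → SkFree k (extend (deleteVertex T a) e)
free-deleteVertex {T = T} a {e} c = free-induced (suc a) ext≡
  where
  ext≡ : ∀ i j → extend (deleteVertex T a) e i j ≡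
                 extend T (insertAt e a c) (punchIn (suc a) i) (punchIn (suc a) j)
  ext≡ zero    zero    = refl
  ext≡ zero    (suc j) = sym (insertAt-punchIn e a c j)
  ext≡ (suc i) zero    = cong not (sym (insertAt-punchIn e a c i))
  ext≡ (suc i) (suc j) = refl

free-reverse : ∀ {x} {T : Arcs x} {d} →
               SkFree k (extend T d) → SkFree k (extend (reverse T) (Vec.map not d))
free-reverse {T = T} {d} free (S , ∣S∣≡k , strong) =
  free (S , ∣S∣≡k , λ i j i∈S j∈S → Reach-reverse ext≡ j∈S (strong j i j∈S i∈S))
  where
  ext≡ : ∀ i j → extend (reverse T) (Vec.map not d) i j ≡ extend T d j i
  ext≡ zero    zero    = refl
  ext≡ zero    (suc j) = lookup-map j not d
  ext≡ (suc i) zero    = trans (cong not (lookup-map i not d)) (not-involutive _)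
  ext≡ (suc i) (suc j) = refl

map-not-injective : ∀ {d e : Vec Bool n} → Vec.map not d ≡ Vec.map not e → d ≡ e
map-not-injective {d = []}    {[]}    _  = refl
map-not-injective {d = _ ∷ _} {_ ∷ _} eq with ∷-injective eq
... | head≡ , tail≡ = cong₂ _∷_ (not-injective head≡) (map-not-injective tail≡)

count-reverse : ∀ {x} {T : Arcs x} → CountAtMost k (reverse T) N → CountAtMost k T N
count-reverse = count-preimage (Vec.map not) (λ _ _ → map-not-injective) free-reverse

Forced : ℕ → Arcs m → Fin m → Fin m → Set
Forced k T a y = ∀ d → lookup d a ≡ true → SkFree k (extend T d) → lookup d y ≡ true

count-by-apex : ∀ {T : Arcs (suc n)} a (ys : List (Fin (suc n))) → Unique (a ∷ ys) →
                All (Forced k T a) ys → CountAtMost k (deleteVertex T a) N₀ →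
                CountAtMost k T (N₀ + 2 ^ (n ∸ length ys))
count-by-apex {n} a ys u forced c₀ = count-split-at a
  (count-fixed-at a false (count-mono (free-deleteVertex a false) c₀))
  (count-mono (λ {d} (free , da) → da ∷ All.map (λ f → f d da free) forced)
              (count-all-true (suc n) (a ∷ ys) u))

-- x = k ∸ 1

king-pair : {T : Arcs (2 + m)} → IsTournament T →
            ∃₂ λ a b → a ≢ b × (∀ j → Reach T ⊤ a j) × (∀ j → Reach T ⊤ j b)
king-pair tour with king tour (∈⊤ {x = zero}) | co-king tour (∈⊤ {x = zero})
... | a , _ , from-a | b , _ , to-b with a ≟ b
... | no  a≢b  = a , b , a≢b , (λ _ → from-a ∈⊤) , (λ _ → to-b ∈⊤)
... | yes refl = a , punchIn a zero , ≢-sym (punchInᵢ≢i a zero) ,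
                 (λ _ → from-a ∈⊤) , (λ _ → to-b ∈⊤ ◅◅ from-a ∈⊤)

count-x≡k∸1 : (T : Arcs (2 + m)) → IsTournament T → CountAtMost (3 + m) T (3 * 2 ^ m)
count-x≡k∸1 {m} T tour with king-pair tour
... | a , b , a≢b , from-a , to-b =
  subst (CountAtMost (3 + m) T) (+-comm (2 * 2 ^ m) (2 ^ m))
    (count-by-apex a (b ∷ []) ((a≢b ∷ []) ∷ [] ∷ []) (b-forced ∷ []) (count-all (suc m)))
  where
  b-forced : Forced (3 + m) T a b
  b-forced d da free with lookup d b in db
  ... | true  = refl
  ... | false = contradiction free
    (¬free-through-u (cong suc (∣⊤∣≡n _)) ∈⊤ (λ {j} _ → from-a j) (λ {j} _ → to-b j) da db)

open RawMonad (¬¬-Monad {a = 0ℓ}) using (pure; _>>=_)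

¬¬-∀-Fin : {P : Fin n → Set} → (∀ i → ¬ ¬ P i) → ¬ ¬ (∀ i → P i)
¬¬-∀-Fin {zero}  _    = pure λ ()
¬¬-∀-Fin {suc n} ¬¬P = do
  p₀ ← ¬¬P zero
  ps ← ¬¬-∀-Fin (¬¬P ∘ suc)
  pure λ { zero → p₀ ; (suc i) → ps i }

¬¬-decide : (P : Fin n → Set) → ¬ ¬ (∀ i → Dec (P i))
¬¬-decide P = ¬¬-∀-Fin (λ _ → ¬¬-excluded-middle)

¬¬-counterexample : {P : Fin n → Fin n → Set} → ¬ (∀ i j → P i j) → ¬ ¬ (∃₂ λ i j → ¬ P i j)
¬¬-counterexample ¬∀ ¬∃ = ¬¬-∀-Fin (λ i → ¬¬-∀-Fin (λ j ¬p → ¬∃ (i , j , ¬p))) ¬∀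

-- Cuts and layerings

record Cut (T : Arcs m) : Set where
  field
    Top        : Subset m
    top        : Fin m
    top∈Top    : top ∈ Top
    bottom     : Fin m
    bottom∉Top : bottom ∉ Top
    Top-beats  : ∀ {w y} → w ∈ Top → y ∉ Top → T w y ≡ true

reverse-cut : {T : Arcs m} → Cut T → Cut (reverse T)
reverse-cut c = record
  { Top        = ∁ Top
  ; top        = bottom
  ; top∈Top    = x∉p⇒x∈∁p bottom∉Top
  ; bottom     = top
  ; bottom∉Top = x∈p⇒x∉∁p top∈Top
  ; Top-beats  = λ w∈∁Top y∉∁Top → Top-beats (x∉∁p⇒x∈p y∉∁Top) (x∈∁p⇒x∉p w∈∁Top)
  }
  where open Cut c

cut-of-unreachable : {T : Arcs m} → IsTournament T → ∀ {i j} → ¬ Reach T ⊤ i j →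
                     (∀ w → Dec (Reach T ⊤ i w)) → Cut T
cut-of-unreachable {T = T} tour {i} {j} ¬i⇝j reach? = record
  { Top        = Top
  ; top        = j
  ; top∈Top    = ∈fromDec⁺ (¬? ∘ reach?) ¬i⇝j
  ; bottom     = i
  ; bottom∉Top = λ i∈Top → ∈fromDec⁻ (¬? ∘ reach?) i∈Top here
  ; Top-beats  = Top-beats
  }
  where
  Top = fromDec (¬? ∘ reach?)

  Top-beats : ∀ {w y} → w ∈ Top → y ∉ Top → T w y ≡ true
  Top-beats {w} {y} w∈Top y∉Top with reach? y
  ... | no ¬i⇝y = contradiction (∈fromDec⁺ (¬? ∘ reach?) ¬i⇝y) y∉Top
  ... | yes i⇝y = beats-unless tour (λ { refl → y∉Top w∈Top })
                    (λ y→w → ∈fromDec⁻ (¬? ∘ reach?) w∈Top (i⇝y ◅◅ edge y→w ∈⊤))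

¬¬-strong-or-cut : {T : Arcs m} → IsTournament T → ¬ ¬ (StronglyConnectedOn T ⊤ ⊎ Cut T)
¬¬-strong-or-cut {T = T} tour = do
  no ¬strong ← ¬¬-excluded-middle
    where yes strong → pure (inj₁ strong)
  i , j , ¬i⇝j ← ¬¬-counterexample {P = Reach T ⊤} (λ i⇝j → ¬strong (λ i j _ _ → i⇝j i j))
  reach? ← ¬¬-decide (Reach T ⊤ i)
  pure (inj₂ (cut-of-unreachable tour ¬i⇝j reach?))

-- A cut is the case hub = apex; in general the apex may lose to vertices below Top.
record Layering (T : Arcs m) : Set where
  field
    Top          : Subset m
    apex         : Fin m
    apex∈Top     : apex ∈ Top
    apex-reaches : ∀ {j} → j ∈ Top → Reach T Top apex j
    hub          : Fin m
    hub∈Top      : hub ∈ Top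
    hub-beats    : ∀ {y} → y ∉ Top → T hub y ≡ true
    Top-beats    : ∀ {w y} → w ∈ Top → w ≢ apex → y ∉ Top → T w y ≡ true

layering-of-cut : {T : Arcs m} → IsTournament T → Cut T → Layering T
layering-of-cut tour c with king tour (Cut.top∈Top c)
... | a , a∈Top , from-a = record
  { Top = Top ; apex = a ; apex∈Top = a∈Top ; apex-reaches = from-a
  ; hub = a ; hub∈Top = a∈Top ; hub-beats = Top-beats a∈Top ; Top-beats = λ w∈Top _ → Top-beats w∈Top }
  where open Cut c

module Layered {T : Arcs (suc n)} (tour : IsTournament T) (L : Layering T) where
  open Layering L

  forced-sink : ∀ {W y} → suc ∣ W ∣ ≡ k → Top ⊆ W → y ∈ W → y ∉ Top →
                (∀ {j} → j ∈ W → j ∉ Top → Reach T W j y) → Forced k T apex y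
  forced-sink {W = W} {y} ∣W∣+1≡k Top⊆W y∈W y∉Top bottom-to-y d da free with lookup d y in dy
  ... | true  = refl
  ... | false = contradiction free (¬free-through-u ∣W∣+1≡k (Top⊆W apex∈Top) from-apex to-y da dy)
    where
    from-apex : ∀ {j} → j ∈ W → Reach T W apex j
    from-apex {j} j∈W with j ∈? Top
    ... | yes j∈Top = Reach-⊆ Top⊆W (apex-reaches j∈Top)
    ... | no  j∉Top = Reach-⊆ Top⊆W (apex-reaches hub∈Top) ◅◅ edge (hub-beats j∉Top) j∈W

    to-y : ∀ {j} → j ∈ W → Reach T W j y
    to-y {j} j∈W with j ∈? Top | j ≟ apex
    ... | no  j∉Top | _         = bottom-to-y j∈W j∉Top
    ... | yes j∈Top | no j≢apex = edge (Top-beats j∈Top j≢apex y∉Top) y∈W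
    ... | yes _     | yes refl  = from-apex (Top⊆W hub∈Top) ◅◅ edge (hub-beats y∉Top) y∈W

  -- y is a sink of the part of W below Top.
  forced-in : ∀ {W r} → suc ∣ W ∣ ≡ k → Top ⊆ W → r ∈ W → r ∉ Top →
              ∃ λ y → y ∈ W × y ∉ Top × Forced k T apex y
  forced-in {W = W} ∣W∣+1≡k Top⊆W r∈W r∉Top with co-king tour (x∈p∩q⁺ (r∈W , x∉p⇒x∈∁p r∉Top))
  ... | y , y∈W∖Top , to-y = y , y∈W , y∉Top ,
    forced-sink ∣W∣+1≡k Top⊆W y∈W y∉Top
      (λ j∈W j∉Top → Reach-⊆ (proj₁ ∘ x∈p∩q⁻ W _) (to-y (x∈p∩q⁺ (j∈W , x∉p⇒x∈∁p j∉Top))))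
    where
    y∈W   = proj₁ (x∈p∩q⁻ W _ y∈W∖Top)
    y∉Top = x∈∁p⇒x∉p (proj₂ (x∈p∩q⁻ W _ y∈W∖Top))

  apex≢ : ∀ {y} → y ∉ Top → apex ≢ y
  apex≢ y∉Top refl = y∉Top apex∈Top

  count-below₂ : Distinct₂ (_∉ Top) → CountAtMost (suc n) (deleteVertex T apex) N₀ →
                 CountAtMost (suc n) T (N₀ + 2 ^ (n ∸ 2))
  count-below₂ (e₁ , e₂ , (e₁∉ , e₂∉) , e₁≢e₂) c₀
    with forced-in (cong suc (∣⊤-x∣≡n e₁)) (⊆- ⊆⊤ e₁∉) (∈⊤- (≢-sym e₁≢e₂)) e₂∉
  ... | y₁ , y₁∈ , y₁∉ , y₁-forced
    with forced-in (cong suc (∣⊤-x∣≡n y₁)) (⊆- ⊆⊤ y₁∉) (∈⊤- (≢-sym (x∈p-y⇒x≢y y₁∈))) e₁∉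
  ... | y₂ , y₂∈ , y₂∉ , y₂-forced =
    count-by-apex apex (y₁ ∷ y₂ ∷ [])
      ((apex≢ y₁∉ ∷ apex≢ y₂∉ ∷ []) ∷ (≢-sym (x∈p-y⇒x≢y y₂∈) ∷ []) ∷ [] ∷ [])
      (y₁-forced ∷ y₂-forced ∷ []) c₀

  count-below₃ : Distinct₃ (_∉ Top) → CountAtMost n (deleteVertex T apex) N₀ →
                 CountAtMost n T (N₀ + 2 ^ (n ∸ 3))
  count-below₃ (e₁ , e₂ , e₃ , (e₁∉ , e₂∉ , e₃∉) , (e₁≢e₂ , e₁≢e₃ , e₂≢e₃)) c₀
    with forced-in (∣⊤-v-w∣+1≡n (≢-sym e₁≢e₂)) (⊆⊤-₂ e₁∉ e₂∉) (∈⊤-₂ (≢-sym e₁≢e₃) (≢-sym e₂≢e₃)) e₃∉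
  ... | y₁ , y₁∈ , y₁∉ , y₁-forced with ∈⊤-₂⁻ y₁∈
  ... | y₁≢e₁ , y₁≢e₂
    with forced-in (∣⊤-v-w∣+1≡n (≢-sym y₁≢e₁)) (⊆⊤-₂ y₁∉ e₁∉) (∈⊤-₂ (≢-sym y₁≢e₂) (≢-sym e₁≢e₂)) e₂∉
  ... | y₂ , y₂∈ , y₂∉ , y₂-forced with ∈⊤-₂⁻ y₂∈
  ... | y₂≢y₁ , y₂≢e₁
    with forced-in (∣⊤-v-w∣+1≡n y₂≢y₁) (⊆⊤-₂ y₁∉ y₂∉) (∈⊤-₂ (≢-sym y₁≢e₁) (≢-sym y₂≢e₁)) e₁∉
  ... | y₃ , y₃∈ , y₃∉ , y₃-forced with ∈⊤-₂⁻ y₃∈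
  ... | y₃≢y₁ , y₃≢y₂ =
    count-by-apex apex (y₁ ∷ y₂ ∷ y₃ ∷ [])
      ((apex≢ y₁∉ ∷ apex≢ y₂∉ ∷ apex≢ y₃∉ ∷ []) ∷ (≢-sym y₂≢y₁ ∷ ≢-sym y₃≢y₁ ∷ []) ∷
       (≢-sym y₃≢y₂ ∷ []) ∷ [] ∷ [])
      (y₁-forced ∷ y₂-forced ∷ y₃-forced ∷ []) c₀

-- x = k

count-layered-x≡k : {T : Arcs (3 + m)} → IsTournament T → (L : Layering T) →
                    Distinct₂ (_∉ Layering.Top L) → CountAtMost (3 + m) T (4 * 2 ^ m)
count-layered-x≡k {m} {T} tour L bottoms =
  subst (CountAtMost (3 + m) T) (+-comm (3 * 2 ^ m) (2 ^ m))
    (count-below₂ bottoms (count-x≡k∸1 _ (deleteVertex-tournament tour apex)))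
  where open Layered tour L
        open Layering L using (apex)

count-x≡k : (T : Arcs (3 + m)) → IsTournament T → CountAtMost (3 + m) T (4 * 2 ^ m)
count-x≡k {m} T tour = count-stable do
  inj₂ c ← ¬¬-strong-or-cut tour
    where inj₁ strong → pure (count-of-strong (∣⊤∣≡n _) strong)
  pure (by-pigeonhole c (pigeonhole 2 (Cut.Top c) (s≤s (s≤s (s≤s (s≤s z≤n))))))
  where
  by-pigeonhole : (c : Cut T) → 2 ≤ ∣ Cut.Top c ∣ ⊎ 2 ≤ ∣ ∁ (Cut.Top c) ∣ →
                  CountAtMost (3 + m) T (4 * 2 ^ m)
  by-pigeonhole c (inj₁ 2≤∣Top∣) = count-reverse
    (count-layered-x≡k (reverse-tournament tour)
      (layering-of-cut (reverse-tournament tour) (reverse-cut c))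
      (Distinct₂-map x∈p⇒x∉∁p (distinct₂ _ 2≤∣Top∣)))
  by-pigeonhole c (inj₂ 2≤∣∁Top∣) = count-layered-x≡k tour (layering-of-cut tour c)
      (Distinct₂-map x∈∁p⇒x∉p (distinct₂ _ 2≤∣∁Top∣))

-- x = k + 1

count-layered-x≡k+1 : {T : Arcs (5 + m)} → IsTournament T → (L : Layering T) →
                      Distinct₃ (_∉ Layering.Top L) → CountAtMost (4 + m) T (5 * 2 ^ suc m)
count-layered-x≡k+1 {m} {T} tour L bottoms =
  subst (CountAtMost (4 + m) T) (+-comm (4 * 2 ^ suc m) (2 ^ suc m))
    (count-below₃ bottoms (count-x≡k _ (deleteVertex-tournament tour apex)))
  where open Layered tour L
        open Layering L using (apex)

module StronglyConnected {m} {T : Arcs (5 + m)} (tour : IsTournament T)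
                         (strong : StronglyConnectedOn T ⊤) where

  a : Fin (5 + m)
  a = zero

  W₀ : Subset (5 + m)
  W₀ = ⊤ - a

  -- U is the initial strong component of T - a (the vertices reaching its king t); Top = U ∪ {a}.
  module InitialComponent (t : Fin (5 + m)) (t∈W₀ : t ∈ W₀)
                          (from-t : ∀ {j} → j ∈ W₀ → Reach T W₀ t j)
                          (reach? : ∀ w → Dec (Reach T W₀ w t)) where

    Top? : ∀ w → Dec (w ≡ a ⊎ Reach T W₀ w t)
    Top? w = w ≟ a ⊎-dec reach? w

    Top U : Subset (5 + m)
    Top = fromDec Top?
    U   = Top - a

    a∈Top : a ∈ Top
    a∈Top = ∈fromDec⁺ Top? (inj₁ refl)

    ∉Top⇒≢a : ∀ {y} → y ∉ Top → y ≢ a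
    ∉Top⇒≢a y∉Top refl = y∉Top a∈Top

    Top⇒U : ∀ {w} → w ∈ Top → w ≢ a → w ∈ U
    Top⇒U = x∈p∧x≢y⇒x∈p-y

    ∈U⁺ : ∀ {w} → w ≢ a → Reach T W₀ w t → w ∈ U
    ∈U⁺ w≢a w⇝t = Top⇒U (∈fromDec⁺ Top? (inj₂ w⇝t)) w≢a

    U⊆Top : U ⊆ Top
    U⊆Top = x∈p-y⇒x∈p {p = Top} {y = a}

    ∈U⇒≢a : ∀ {w} → w ∈ U → w ≢ a
    ∈U⇒≢a = x∈p-y⇒x≢y {p = Top}

    ∈W₀⇒≢a : ∀ {w} → w ∈ W₀ → w ≢ a
    ∈W₀⇒≢a = x∈p-y⇒x≢y {p = ⊤}

    U⊆W₀ : U ⊆ W₀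
    U⊆W₀ = ∈⊤- ∘ ∈U⇒≢a

    U-reaches-t : ∀ {w} → w ∈ U → Reach T W₀ w t
    U-reaches-t w∈U with ∈fromDec⁻ Top? (U⊆Top w∈U)
    ... | inj₁ w≡a = contradiction w≡a (∈U⇒≢a w∈U)
    ... | inj₂ w⇝t = w⇝t

    t∈U : t ∈ U
    t∈U = ∈U⁺ (∈W₀⇒≢a t∈W₀) here

    U-beats : ∀ {w y} → w ∈ U → y ∉ Top → T w y ≡ true
    U-beats w∈U y∉Top = beats-unless tour (λ { refl → y∉Top (U⊆Top w∈U) })
      (λ y→w → y∉Top (∈fromDec⁺ Top? (inj₂ (edge y→w (U⊆W₀ w∈U) ◅◅ U-reaches-t w∈U))))

    U-strong : ∀ {w j} → w ∈ U → j ∈ U → Reach T U w j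
    U-strong w∈U j∈U = Reach-restrict (λ l∈W₀ l⇝j → ∈U⁺ (∈W₀⇒≢a l∈W₀) (l⇝j ◅◅ U-reaches-t j∈U))
                                      (U-reaches-t w∈U ◅◅ from-t (U⊆W₀ j∈U))

    ¬¬-bottom : ¬ StronglyConnectedOn T W₀ → ¬ ¬ ∃ (_∉ Top)
    ¬¬-bottom ¬W₀-strong ¬∃ = ¬W₀-strong (λ i j i∈W₀ j∈W₀ → U-reaches-t (in-U i∈W₀) ◅◅ from-t j∈W₀)
      where
      in-U : ∀ {i} → i ∈ W₀ → i ∈ U
      in-U {i} i∈W₀ with i ∈? Top
      ... | yes i∈Top = Top⇒U i∈Top (∈W₀⇒≢a i∈W₀)
      ... | no  i∉Top = contradiction (i , i∉Top) ¬∃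

    hub : ∃ λ p₀ → p₀ ∈ U × T a p₀ ≡ true
    hub with Reach-crossing U (strong a t ∈⊤ ∈⊤) (x∉p-x Top a) t∈U
    ... | l , l′ , l∉U , l′∈U , l→l′ with l ≟ a
    ... | yes refl = l′ , l′∈U , l→l′
    ... | no  l≢a  = ⊥-elim (¬mutual tour (λ { refl → l∉U l′∈U }) (U-beats l′∈U l∉Top) l→l′)
      where l∉Top = λ l∈Top → l∉U (Top⇒U l∈Top l≢a)

    entry : ∀ {v} → v ∉ Top → ∃ λ v₀ → v₀ ∉ Top × T v₀ a ≡ true
    entry v∉Top with Reach-crossing Top (strong _ t ∈⊤ ∈⊤) v∉Top (U⊆Top t∈U)
    ... | l , l′ , l∉Top , l′∈Top , l→l′ with l′ ≟ a
    ... | yes refl = l , l∉Top , l→l′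
    ... | no  l′≢a = ⊥-elim (¬mutual tour (λ { refl → l∉Top l′∈Top })
                                          (U-beats (Top⇒U l′∈Top l′≢a) l∉Top) l→l′)

    module Hub {p₀} (p₀∈U : p₀ ∈ U) (a→p₀ : T a p₀ ≡ true)
               {v₀} (v₀∉Top : v₀ ∉ Top) (v₀→a : T v₀ a ≡ true) where

      a-reaches : ∀ {S} → U ⊆ S → ∀ {j} → j ∈ Top → Reach T S a j
      a-reaches U⊆S {j} j∈Top with j ≟ a
      ... | yes refl = here
      ... | no  j≢a  = edge a→p₀ (U⊆S p₀∈U) ◅◅ Reach-⊆ U⊆S (U-strong p₀∈U (Top⇒U j∈Top j≢a))

      layering : Layering T
      layering = record
        { Top = Top ; apex = a ; apex∈Top = a∈Top ; apex-reaches = a-reaches U⊆Top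
        ; hub = p₀ ; hub∈Top = U⊆Top p₀∈U ; hub-beats = U-beats p₀∈U
        ; Top-beats = λ w∈Top w≢a → U-beats (Top⇒U w∈Top w≢a) }

      reaches-a-via-v₀ : ∀ {S} → a ∈ S → v₀ ∈ S → (∀ {y} → y ∈ S → y ∉ Top → y ≡ v₀) →
                         ∀ {i} → i ∈ S → Reach T S i a
      reaches-a-via-v₀ a∈S v₀∈S only-v₀ {i} i∈S with i ∈? Top | i ≟ a
      ... | _         | yes refl = here
      ... | yes i∈Top | no  i≢a  = edge (U-beats (Top⇒U i∈Top i≢a) v₀∉Top) v₀∈S ◅◅ edge v₀→a a∈S
      ... | no  i∉Top | no  _ with refl ← only-v₀ i∈S i∉Top = edge v₀→a a∈S

      strong-without-second : ∀ {v₁} → v₁ ∉ Top → v₁ ≢ v₀ → (∀ {y} → y ∉ Top → y ≢ v₁ → y ≡ v₀) →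
                              StronglyConnectedOn T (⊤ - v₁)
      strong-without-second {v₁} v₁∉Top v₁≢v₀ only =
        strong-via-hub (reaches-a-via-v₀ a∈S v₀∈S only-v₀) from-a
        where
        a∈S  = ∈⊤- (≢-sym (∉Top⇒≢a v₁∉Top))
        v₀∈S = ∈⊤- (≢-sym v₁≢v₀)
        U⊆S : U ⊆ ⊤ - v₁
        U⊆S = ⊆- ⊆⊤ (v₁∉Top ∘ U⊆Top)
        only-v₀ : ∀ {y} → y ∈ ⊤ - v₁ → y ∉ Top → y ≡ v₀
        only-v₀ y∈S y∉Top = only y∉Top (x∈p-y⇒x≢y {p = ⊤} y∈S)
        from-a : ∀ {j} → j ∈ ⊤ - v₁ → Reach T (⊤ - v₁) a j
        from-a {j} j∈S with j ∈? Top
        ... | yes j∈Top = a-reaches U⊆S j∈Top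
        ... | no  j∉Top with refl ← only-v₀ j∈S j∉Top =
          edge a→p₀ (U⊆S p₀∈U) ◅◅ edge (U-beats p₀∈U v₀∉Top) v₀∈S

      module SingleBottom (only : ∀ {y} → y ∉ Top → y ≡ v₀) where

        strong-without-v₀ : ∀ {u₁} → u₁ ∈ U → T u₁ a ≡ true → StronglyConnectedOn T (⊤ - v₀)
        strong-without-v₀ {u₁} u₁∈U u₁→a = strong-via-hub to-a from-a
          where
          U⊆S : U ⊆ ⊤ - v₀
          U⊆S = ⊆- ⊆⊤ (v₀∉Top ∘ U⊆Top)
          in-Top : ∀ {i} → i ∈ ⊤ - v₀ → i ∈ Top
          in-Top {i} i∈S with i ∈? Top
          ... | yes i∈Top = i∈Top
          ... | no  i∉Top = contradiction (only i∉Top) (x∈p-y⇒x≢y {p = ⊤} i∈S)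
          to-a : ∀ {i} → i ∈ ⊤ - v₀ → Reach T (⊤ - v₀) i a
          to-a {i} i∈S with i ≟ a
          ... | yes refl = here
          ... | no  i≢a  = Reach-⊆ U⊆S (U-strong (Top⇒U (in-Top i∈S) i≢a) u₁∈U)
                           ◅◅ edge u₁→a (∈⊤- (∉Top⇒≢a v₀∉Top ∘ sym))
          from-a : ∀ {j} → j ∈ ⊤ - v₀ → Reach T (⊤ - v₀) a j
          from-a j∈S = a-reaches U⊆S (in-Top j∈S)

        strong-without-hub : (∀ {w} → w ∈ U → T a w ≡ true) → (∃ λ z → z ∈ U × z ≢ p₀) →
                             StronglyConnectedOn T (⊤ - p₀)
        strong-without-hub a-beats (z , z∈U , z≢p₀) =
          strong-via-hub (reaches-a-via-v₀ a∈S v₀∈S (λ _ → only)) from-a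
          where
          a∈S  = ∈⊤- (∈U⇒≢a p₀∈U ∘ sym)
          v₀∈S = ∈⊤- (λ { refl → v₀∉Top (U⊆Top p₀∈U) })
          from-a : ∀ {j} → j ∈ ⊤ - p₀ → Reach T (⊤ - p₀) a j
          from-a {j} j∈S with j ∈? Top | j ≟ a
          ... | _         | yes refl = here
          ... | yes j∈Top | no  j≢a  = edge (a-beats (Top⇒U j∈Top j≢a)) j∈S
          ... | no  j∉Top | _ with refl ← only j∉Top =
            edge (a-beats z∈U) (∈⊤- z≢p₀) ◅◅ edge (U-beats z∈U v₀∉Top) v₀∈S

        ∣⊤-a-v₀-p₀∣ : ∣ ⊤ - a - v₀ - p₀ ∣ ≡ 2 + m
        ∣⊤-a-v₀-p₀∣ = suc-injective (suc-injective (trans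
          (cong suc (∣p-x∣+1≡∣p∣ (⊤ - a - v₀) (∈⊤-₂ (∈U⇒≢a p₀∈U) (λ { refl → v₀∉Top (U⊆Top p₀∈U) }))))
          (∣⊤-v-w∣+1≡n (∉Top⇒≢a v₀∉Top))))

        other-in-U : ∃ λ z → z ∈ U × z ≢ p₀
        other-in-U with ∃-member (⊤ - a - v₀ - p₀) (subst (1 ≤_) (sym ∣⊤-a-v₀-p₀∣) (s≤s z≤n))
        ... | z , z∈X with ∈⊤-₂⁻ (x∈p-y⇒x∈p {p = ⊤ - a - v₀} z∈X)
        ... | z≢a , z≢v₀ = z , Top⇒U z∈Top z≢a , x∈p-y⇒x≢y {p = ⊤ - a - v₀} z∈X
          where
          z∈Top : z ∈ Top
          z∈Top with z ∈? Top
          ... | yes z∈Top = z∈Top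
          ... | no  z∉Top = contradiction (only z∉Top) z≢v₀

        count : ¬ ¬ CountAtMost (4 + m) T (5 * 2 ^ suc m)
        count = do
          yes (u₁ , u₁∈U , u₁→a) ← ¬¬-excluded-middle {A = ∃ λ u₁ → u₁ ∈ U × T u₁ a ≡ true}
            where no ¬u₁ → pure (count-of-strong (∣⊤-x∣≡n p₀)
                                   (strong-without-hub (a-beats ¬u₁) other-in-U))
          pure (count-of-strong (∣⊤-x∣≡n v₀) (strong-without-v₀ u₁∈U u₁→a))
          where
          a-beats : ¬ (∃ λ u₁ → u₁ ∈ U × T u₁ a ≡ true) → ∀ {w} → w ∈ U → T a w ≡ true
          a-beats ¬u₁ w∈U = beats-unless tour (≢-sym (∈U⇒≢a w∈U)) (λ w→a → ¬u₁ (_ , w∈U , w→a))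

      count : ¬ ¬ CountAtMost (4 + m) T (5 * 2 ^ suc m)
      count = do
        yes (v₁ , v₁∉Top , v₁≢v₀) ← ¬¬-excluded-middle {A = ∃ λ v₁ → v₁ ∉ Top × v₁ ≢ v₀}
          where no ¬v₁ → SingleBottom.count (λ {y} y∉Top →
                  decidable-stable (y ≟ v₀) (λ y≢v₀ → ¬v₁ (y , y∉Top , y≢v₀)))
        yes (v₂ , v₂∉Top , v₂≢v₀ , v₂≢v₁) ←
          ¬¬-excluded-middle {A = ∃ λ v₂ → v₂ ∉ Top × v₂ ≢ v₀ × v₂ ≢ v₁}
          where no ¬v₂ → pure (count-of-strong (∣⊤-x∣≡n v₁) (strong-without-second v₁∉Top v₁≢v₀
                  (λ {y} y∉Top y≢v₁ →
                     decidable-stable (y ≟ v₀) (λ y≢v₀ → ¬v₂ (y , y∉Top , y≢v₀ , y≢v₁)))))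
        pure (count-layered-x≡k+1 tour layering
          (v₀ , v₁ , v₂ , (v₀∉Top , v₁∉Top , v₂∉Top) , (≢-sym v₁≢v₀ , ≢-sym v₂≢v₀ , ≢-sym v₂≢v₁)))

  count-strong : ¬ ¬ CountAtMost (4 + m) T (5 * 2 ^ suc m)
  count-strong = do
    no ¬W₀-strong ← ¬¬-excluded-middle
      where yes W₀-strong → pure (count-of-strong (∣⊤-x∣≡n a) W₀-strong)
    t , t∈W₀ , from-t ← pure (king tour (∈⊤- {v = a} {w = suc zero} λ ()))
    reach? ← ¬¬-decide (λ w → Reach T W₀ w t)
    let open InitialComponent t t∈W₀ from-t reach?
    v , v∉Top ← ¬¬-bottom ¬W₀-strong
    p₀ , p₀∈U , a→p₀ ← pure hub
    v₀ , v₀∉Top , v₀→a ← pure (entry v∉Top)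
    Hub.count p₀∈U a→p₀ v₀∉Top v₀→a

count-x≡k+1 : (T : Arcs (5 + m)) → IsTournament T → CountAtMost (4 + m) T (5 * 2 ^ suc m)
count-x≡k+1 {m} T tour = count-stable do
  inj₂ c ← ¬¬-strong-or-cut tour
    where inj₁ strong → StronglyConnected.count-strong tour strong
  pure (by-pigeonhole c (pigeonhole 3 (Cut.Top c) (s≤s (s≤s (s≤s (s≤s (s≤s (s≤s z≤n))))))))
  where
  by-pigeonhole : (c : Cut T) → 3 ≤ ∣ Cut.Top c ∣ ⊎ 3 ≤ ∣ ∁ (Cut.Top c) ∣ →
                  CountAtMost (4 + m) T (5 * 2 ^ suc m)
  by-pigeonhole c (inj₁ 3≤∣Top∣) = count-reverse
    (count-layered-x≡k+1 (reverse-tournament tour)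
      (layering-of-cut (reverse-tournament tour) (reverse-cut c))
      (Distinct₃-map x∈p⇒x∉∁p (distinct₃ _ 3≤∣Top∣)))
  by-pigeonhole c (inj₂ 3≤∣∁Top∣) = count-layered-x≡k+1 tour (layering-of-cut tour c)
      (Distinct₃-map x∈∁p⇒x∉p (distinct₃ _ 3≤∣∁Top∣))

c+m+4∸[4+m]≡c : ∀ c m → c + m + 4 ∸ (4 + m) ≡ c
c+m+4∸[4+m]≡c c m = trans (cong (_∸ (4 + m)) (trans (+-assoc c m 4) (cong (c +_) (+-comm m 4))))
                          (m+n∸n≡m c (4 + m))

rescale : ∀ c m {x} {T : Arcs x} → CountAtMost (4 + m) T (c * 2 ^ suc m) →
          CountAtMost (4 + m) T ((c + m + 4 ∸ (4 + m)) * 2 ^ suc m)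
rescale c m {T = T} = subst (λ c′ → CountAtMost (4 + m) T (c′ * 2 ^ suc m)) (sym (c+m+4∸[4+m]≡c c m))

-- The graph data only witness that K ∪ {u} is complete; the count depends on T alone.
lemma3p3 : (k : ℕ) → 4 ≤ k → (n : ℕ) (G : Graph n) (x : ℕ)
    → (x ≡ k ∸ 1 ⊎ x ≡ k ⊎ x ≡ suc k)
    → (emb : Fin x → Fin n) → Injective _≡_ _≡_ emb
    → (∀ i j → i ≢ j → Graph.Adj G (emb i) (emb j))
    → (u : Fin n) → (∀ i → emb i ≢ u) → (∀ i → Graph.Adj G u (emb i))
    → (T : Fin x → Fin x → Bool) → IsTournament T
    → CountAtMost k T ((x + 4 ∸ k) * 2 ^ (k ∸ 3))
lemma3p3 (suc (suc (suc (suc m)))) (s≤s (s≤s (s≤s (s≤s _)))) _ _ _ (inj₁ refl)        _ _ _ _ _ _ T tour =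
  rescale 3 m (count-x≡k∸1 T tour)
lemma3p3 (suc (suc (suc (suc m)))) (s≤s (s≤s (s≤s (s≤s _)))) _ _ _ (inj₂ (inj₁ refl)) _ _ _ _ _ _ T tour =
  rescale 4 m (count-x≡k T tour)
lemma3p3 (suc (suc (suc (suc m)))) (s≤s (s≤s (s≤s (s≤s _)))) _ _ _ (inj₂ (inj₂ refl)) _ _ _ _ _ _ T tour =
  rescale 5 m (count-x≡k+1 T tour)
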